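{- Let $\mathbf{T}$ be the rooted plane tree whose nodes are all inversion sequences (of all lengths $\ge 1$) avoiding $120$, $201$, and $210$, with root the sequence $0$, and in which the children of a node $e=e_1\cdots e_L$ are the sequences $e\,i$ (obtained by appending a letter $i\in\{0,1,\dots,L\}$) that still avoid the three patterns, ordered by increasing $i$. For a node $e$ let $\mathbf{T}(e)$ denote the subtree of $\mathbf{T}$ rooted at $e$. For $m\ge 1$ let $a_m=0^m$ (the word of $m$ zeros) and for $1\le j\le m$ let $b_{m,j}=0^m j$. Then: (i) the children of $a_m$ are exactly $a_{m+1}, b_{m,1},\dots,b_{m,m}$; (ii) for $1\le j\le m$, the children of $b_{m,j}$ are $0^m j k$ for $k=0,1,\dots,m+1$, and $\mathbf{T}(0^m j k)\cong \mathbf{T}(b_{m+2-j,1})$ for $0\le k\le j-1$, $\mathbf{T}(0^m j j)\cong \mathbf{T}(b_{m+1,j})$, and $\mathbf{T}(0^m j k)\cong \mathbf{T}(b_{m+1-j,k-j})$ for $j+1\le k\le m+1$, where $\cong$ denotes isomorphism of rooted plane trees. In succession-rule notation: $a_m\rightsquigarrow a_{m+1},b_{m,1},\dots,b_{m,m}$ and $b_{m,j}\rightsquigarrow (b_{m+2-j,1})^j, b_{m+1,j}, b_{m+1-j,1},\dots,b_{m+1-j,m+1-j}$.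
   Context: An inversion sequence of length $L$ is a word $e_1\cdots e_L$ of integers with $0\le e_i\le i-1$. A word $w$ contains a pattern $p=p_1\cdots p_m$ if it has a subsequence $w_{\alpha_1}\cdots w_{\alpha_m}$ ($\alpha_1<\cdots<\alpha_m$) with $w_{\alpha_i}<w_{\alpha_j}$ iff $p_i<p_j$ and $w_{\alpha_i}=w_{\alpha_j}$ iff $p_i=p_j$; otherwise it avoids $p$. In a succession rule, an exponent $j$ on a label means $j$ children with subtrees isomorphic to that label's subtree. -}

module Defs where

open import Data.Nat using (ℕ; zero; suc; _+_; _<ᵇ_; _≡ᵇ_)
open import Data.Bool using (Bool; true; false; _∧_; _∨_; not; if_then_else_)
open import Data.List using (List; []; _∷_; _++_; [_]; length; map; filter; upTo; zip; replicate)
open import Data.Bool.ListAction using (all; any)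
open import Data.List.Relation.Binary.Pointwise using (Pointwise)
open import Data.Product using (Σ; _×_; _,_; proj₁; proj₂)
open import Relation.Binary.PropositionalEquality using (_≡_)
open import Relation.Nullary.Decidable using (Dec; yes; no)
open import Data.Bool using (_≟_)

Word : Set
Word = List ℕ

cmp : ℕ → ℕ → ℕ
cmp x y = if x <ᵇ y then 0 else (if x ≡ᵇ y then 1 else 2)

sameOrder : Word → Word → Bool
sameOrder [] [] = true
sameOrder (x ∷ xs) (y ∷ ys) =
  all (λ q → cmp x (proj₁ q) ≡ᵇ cmp y (proj₂ q)) (zip xs ys) ∧ sameOrder xs ys
sameOrder _ _ = false

subseqs : Word → List Word
subseqs [] = [] ∷ []
subseqs (x ∷ xs) = map (x ∷_) (subseqs xs) ++ subseqs xs

contains : Word → Word → Bool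
contains w p = any (λ s → sameOrder s p) (subseqs w)

avoids3 : Word → Bool
avoids3 w = not (contains w (1 ∷ 2 ∷ 0 ∷ [])
              ∨ contains w (2 ∷ 0 ∷ 1 ∷ [])
              ∨ contains w (2 ∷ 1 ∷ 0 ∷ []))

children : Word → List Word
children e = filter (λ w → avoids3 w ≟ true) (map (λ i → e ++ [ i ]) (upTo (suc (length e))))

-- isomorphism of the (finitely branching, rooted plane) subtrees T(e) and T(f):
-- existence of an order-preserving bisimulation relating e and f
_≅_ : Word → Word → Set₁
e ≅ f = Σ (Word → Word → Set) λ R →
          R e f × (∀ x y → R x y → Pointwise R (children x) (children y))

aw : ℕ → Word
aw m = replicate m 0

bw : ℕ → ℕ → Word
bw m j = replicate m 0 ++ [ j ]

{-# OPTIONS --safe #-}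
module Submission where

open import Defs
open import Data.Nat using (ℕ; zero; suc; _+_; _∸_; _≤_; _<_; _<ᵇ_; _≡ᵇ_; z≤n; z<s; s<s)
open import Data.Nat.Properties
  using ( <⇒<ᵇ; <ᵇ⇒<; ≡⇒≡ᵇ; ≡ᵇ⇒≡; <-cmp; ≤-refl; ≤-trans; ≤-antisym; ≤-pred; <⇒≤; ≤⇒≯; <⇒≢; >⇒≢
        ; <-asym; <-trans; <-≤-trans; +-comm; +-assoc; +-suc; +-identityʳ; m≤m+n; m<m+n; +-monoʳ-<
        ; +-cancelˡ-≤; m+n∸m≡n; m≤n⇒∃[o]m+o≡n )
open import Data.Bool using (Bool; true; false; _∧_; _∨_; not; T)
open import Data.Bool.Properties
  using ( _≟_; T-≡; ∨-assoc; ∨-comm; ∨-identityʳ; ∨-zeroʳ; ∧-identityʳ; ∧-zeroʳ; ∧-assoc; ∧-distribʳ-∨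
        ; ∨-commutativeMonoid; ∨-∧-booleanAlgebra )
open import Data.Bool.ListAction using (any; all; or)
open import Data.List using (List; []; _∷_; _++_; [_]; map; length; zip; applyUpTo; upTo; filter; replicate)
open import Data.List.Properties
  using (map-applyUpTo; map-upTo; map-∘; map-cong; length-++; filter-++; filter-all; filter-none; ++-identityʳ)
open import Data.List.Relation.Unary.All.Properties using (applyUpTo⁺₁)
open import Data.List.Relation.Binary.Pointwise using (Pointwise; []; _∷_; ++⁺)
open import Data.Product using (Σ; _×_; _,_; proj₁; proj₂)
open import Data.Sum using (_⊎_; inj₁; inj₂)
open import Data.Empty using (⊥-elim)
open import Function using (_∘_)
open import Function.Bundles using (Equivalence)
open import Level using (Level)
open import Relation.Nullary using (¬_)
open import Relation.Unary using (Pred; Decidable)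
open import Relation.Binary.Definitions using (tri<; tri≈; tri>)
open import Relation.Binary.PropositionalEquality
  using (_≡_; _≢_; refl; sym; trans; cong; cong₂; subst; subst₂; ≢-sym; module ≡-Reasoning)
open import Algebra.Bundles using (CommutativeMonoid)
open import Algebra.Properties.CommutativeSemigroup (CommutativeMonoid.commutativeSemigroup ∨-commutativeMonoid)
  using (interchange)
open import Algebra.Lattice.Properties.BooleanAlgebra ∨-∧-booleanAlgebra using (deMorgan₂)

-- Appending a letter x to a word e that avoids 120, 201 and 210 creates an
-- occurrence exactly when e has letters y before z with x < y and z ∉ {x, y}.
-- So if M is the largest letter of e and every other letter is at most a, the
-- admissible letters form two intervals [a, a + s) and [M, |e|].  With
-- c = |e| + 1 − M, the label (s, c) of e determines the labels of its children,
--   (s, c) ⇝ (1, c + 1)^s, (s, c + 1), (1, c), (2, c − 1), …, (c − 1, 2),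
-- hence words with equal labels have isomorphic subtrees.  The word a_m has
-- label (0, m + 1) and b_{m,j} has label (j, m + 2 − j).

private
  variable
    ℓ ℓ′ : Level
    A B : Set ℓ

¬T⇒≡false : ∀ {b} → ¬ T b → b ≡ false
¬T⇒≡false {false} _ = refl
¬T⇒≡false {true} ¬t = ⊥-elim (¬t _)

<ᵇ≡true : ∀ {m n} → m < n → (m <ᵇ n) ≡ true
<ᵇ≡true m<n = Equivalence.to T-≡ (<⇒<ᵇ m<n)

<ᵇ≡false : ∀ {m n} → n ≤ m → (m <ᵇ n) ≡ false
<ᵇ≡false {m} {n} n≤m = ¬T⇒≡false (≤⇒≯ n≤m ∘ <ᵇ⇒< m n)

≡ᵇ-refl : ∀ n → (n ≡ᵇ n) ≡ true
≡ᵇ-refl n = Equivalence.to T-≡ (≡⇒≡ᵇ n n refl)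

≡ᵇ≡false : ∀ {m n} → m ≢ n → (m ≡ᵇ n) ≡ false
≡ᵇ≡false {m} {n} m≢n = ¬T⇒≡false (m≢n ∘ ≡ᵇ⇒≡ m n)

any-++ : ∀ (f : A → Bool) xs ys → any f (xs ++ ys) ≡ any f xs ∨ any f ys
any-++ f [] ys = refl
any-++ f (x ∷ xs) ys = trans (cong (f x ∨_) (any-++ f xs ys)) (sym (∨-assoc (f x) (any f xs) (any f ys)))

any-∷ʳ : ∀ (f : A → Bool) xs x → any f (xs ++ [ x ]) ≡ any f xs ∨ f x
any-∷ʳ f xs x = trans (any-++ f xs [ x ]) (cong (any f xs ∨_) (∨-identityʳ (f x)))

any-map : ∀ (f : B → Bool) (g : A → B) xs → any f (map g xs) ≡ any (f ∘ g) xs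
any-map f g xs = cong or (sym (map-∘ xs))

any-cong : ∀ {f g : A → Bool} xs → (∀ x → f x ≡ g x) → any f xs ≡ any g xs
any-cong xs f≗g = cong or (map-cong f≗g xs)

any-false : ∀ {f : A → Bool} xs → (∀ x → f x ≡ false) → any f xs ≡ false
any-false [] _ = refl
any-false (x ∷ xs) f≡false = cong₂ _∨_ (f≡false x) (any-false xs f≡false)

any-∨ : ∀ (f g : A → Bool) xs → any (λ x → f x ∨ g x) xs ≡ any f xs ∨ any g xs
any-∨ f g [] = refl
any-∨ f g (x ∷ xs) =
  trans (cong ((f x ∨ g x) ∨_) (any-∨ f g xs)) (interchange (f x) (g x) (any f xs) (any g xs))

any-∧ʳ : ∀ (f : A → Bool) b xs → any (λ x → f x ∧ b) xs ≡ any f xs ∧ b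
any-∧ʳ f b [] = refl
any-∧ʳ f b (x ∷ xs) = trans (cong ((f x ∧ b) ∨_) (any-∧ʳ f b xs)) (sym (∧-distribʳ-∨ b (f x) (any f xs)))

length-∷ʳ : ∀ (xs : List A) x → length (xs ++ [ x ]) ≡ suc (length xs)
length-∷ʳ xs x = trans (length-++ xs) (+-comm (length xs) 1)

replicate-∷ʳ : ∀ n (x : A) → replicate n x ++ [ x ] ≡ replicate (suc n) x
replicate-∷ʳ zero x = refl
replicate-∷ʳ (suc n) x = cong (x ∷_) (replicate-∷ʳ n x)

applyUpTo-+ : ∀ (f : ℕ → A) m n → applyUpTo f (m + n) ≡ applyUpTo f m ++ applyUpTo (f ∘ (m +_)) n
applyUpTo-+ f zero n = refl
applyUpTo-+ f (suc m) n = cong (f 0 ∷_) (applyUpTo-+ (f ∘ suc) m n)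

applyUpTo⁺ : ∀ {R : A → B → Set ℓ′} (f : ℕ → A) (g : ℕ → B) n → (∀ {i} → i < n → R (f i) (g i)) →
  Pointwise R (applyUpTo f n) (applyUpTo g n)
applyUpTo⁺ f g zero _ = []
applyUpTo⁺ f g (suc n) R-fg = R-fg z<s ∷ applyUpTo⁺ (f ∘ suc) (g ∘ suc) n (R-fg ∘ s<s)

filter-applyUpTo-interval : ∀ {P : Pred A ℓ′} (P? : Decidable P) (f : ℕ → A) {a s n} → a + s ≤ n →
  (∀ {i} → i < a → ¬ P (f i)) →
  (∀ {i} → a ≤ i → i < a + s → P (f i)) →
  (∀ {i} → a + s ≤ i → i < n → ¬ P (f i)) →
  filter P? (applyUpTo f n) ≡ applyUpTo (f ∘ (a +_)) s
filter-applyUpTo-interval {A = A} P? f {a} {s} a+s≤n below inside above with m≤n⇒∃[o]m+o≡n a+s≤n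
... | g , refl = begin
    filter P? (applyUpTo f (a + s + g))
  ≡⟨ cong (filter P?) (trans (applyUpTo-+ f (a + s) g) (cong (_++ segment₃) (applyUpTo-+ f a s))) ⟩
    filter P? ((segment₁ ++ segment₂) ++ segment₃)
  ≡⟨ trans (filter-++ P? (segment₁ ++ segment₂) segment₃)
           (cong (_++ filter P? segment₃) (filter-++ P? segment₁ segment₂)) ⟩
    (filter P? segment₁ ++ filter P? segment₂) ++ filter P? segment₃
  ≡⟨ cong₂ _++_ (cong₂ _++_ none₁ all₂) none₃ ⟩
    segment₂ ++ []
  ≡⟨ ++-identityʳ segment₂ ⟩
    segment₂
  ∎
  where
  open ≡-Reasoning
  segment₁ segment₂ segment₃ : List A
  segment₁ = applyUpTo f a
  segment₂ = applyUpTo (f ∘ (a +_)) s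
  segment₃ = applyUpTo (f ∘ (a + s +_)) g
  none₁ : filter P? segment₁ ≡ []
  none₁ = filter-none P? (applyUpTo⁺₁ f a below)
  all₂ : filter P? segment₂ ≡ segment₂
  all₂ = filter-all P? (applyUpTo⁺₁ (f ∘ (a +_)) s (λ i<s → inside (m≤m+n a _) (+-monoʳ-< a i<s)))
  none₃ : filter P? segment₃ ≡ []
  none₃ = filter-none P?
    (applyUpTo⁺₁ (f ∘ (a + s +_)) g (λ i<g → above (m≤m+n (a + s) _) (+-monoʳ-< (a + s) i<g)))

any-subseqs-∷ : ∀ (P : Word → Bool) y e →
  any P (subseqs (y ∷ e)) ≡ any (P ∘ (y ∷_)) (subseqs e) ∨ any P (subseqs e)
any-subseqs-∷ P y e =
  trans (any-++ P (map (y ∷_) (subseqs e)) (subseqs e))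
        (cong (_∨ any P (subseqs e)) (any-map P (y ∷_) (subseqs e)))

any-subseqs-∷ʳ : ∀ (P : Word → Bool) e x →
  any P (subseqs (e ++ [ x ])) ≡ any P (subseqs e) ∨ any (P ∘ (_++ [ x ])) (subseqs e)
any-subseqs-∷ʳ P [] x =
  trans (∨-comm (P [ x ]) (P [] ∨ false)) (cong ((P [] ∨ false) ∨_) (sym (∨-identityʳ (P [ x ]))))
any-subseqs-∷ʳ P (y ∷ e) x = begin
    any P (subseqs (y ∷ e ++ [ x ]))
  ≡⟨ any-subseqs-∷ P y (e ++ [ x ]) ⟩
    any (P ∘ (y ∷_)) (subseqs (e ++ [ x ])) ∨ any P (subseqs (e ++ [ x ]))
  ≡⟨ cong₂ _∨_ (any-subseqs-∷ʳ (P ∘ (y ∷_)) e x) (any-subseqs-∷ʳ P e x) ⟩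
    (any (P ∘ (y ∷_)) S ∨ any (P ∘ (y ∷_) ∘ (_++ [ x ])) S) ∨ (any P S ∨ any (P ∘ (_++ [ x ])) S)
  ≡⟨ interchange (any (P ∘ (y ∷_)) S) _ _ _ ⟩
    (any (P ∘ (y ∷_)) S ∨ any P S) ∨ (any (P ∘ (y ∷_) ∘ (_++ [ x ])) S ∨ any (P ∘ (_++ [ x ])) S)
  ≡⟨ sym (cong₂ _∨_ (any-subseqs-∷ P y e) (any-subseqs-∷ (P ∘ (_++ [ x ])) y e)) ⟩
    any P (subseqs (y ∷ e)) ∨ any (P ∘ (_++ [ x ])) (subseqs (y ∷ e))
  ∎
  where
  open ≡-Reasoning
  S : List Word
  S = subseqs e

any-subseqs-[] : ∀ (P : Word → Bool) e → (∀ y s → P (y ∷ s) ≡ false) → any P (subseqs e) ≡ P []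
any-subseqs-[] P [] _ = ∨-identityʳ (P [])
any-subseqs-[] P (y ∷ e) P∷≡false =
  trans (any-subseqs-∷ P y e)
        (cong₂ _∨_ (any-false (subseqs e) (P∷≡false y)) (any-subseqs-[] P e P∷≡false))

any-subseqs-singletons : ∀ (P : Word → Bool) e → P [] ≡ false → (∀ y z s → P (y ∷ z ∷ s) ≡ false) →
  any P (subseqs e) ≡ any (λ y → P [ y ]) e
any-subseqs-singletons P [] P[]≡false _ = cong (_∨ false) P[]≡false
any-subseqs-singletons P (y ∷ e) P[]≡false P∷∷≡false =
  trans (any-subseqs-∷ P y e)
        (cong₂ _∨_ (any-subseqs-[] (P ∘ (y ∷_)) e (P∷∷≡false y))
                   (any-subseqs-singletons P e P[]≡false P∷∷≡false))

-- Occurrences of 120, 201 and 210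

sameOrder-length : ∀ s p → length s ≢ length p → sameOrder s p ≡ false
sameOrder-length [] [] ≢ = ⊥-elim (≢ refl)
sameOrder-length [] (_ ∷ _) _ = refl
sameOrder-length (_ ∷ _) [] _ = refl
sameOrder-length (x ∷ s) (y ∷ p) ≢ =
  trans (cong (heads ∧_) (sameOrder-length s p (≢ ∘ cong suc))) (∧-zeroʳ heads)
  where
  heads : Bool
  heads = all (λ q → cmp x (proj₁ q) ≡ᵇ cmp y (proj₂ q)) (zip s p)

sameOrder-triple : ∀ y w x p q r → sameOrder (y ∷ w ∷ x ∷ []) (p ∷ q ∷ r ∷ []) ≡
  (cmp y w ≡ᵇ cmp p q) ∧ (cmp y x ≡ᵇ cmp p r) ∧ (cmp w x ≡ᵇ cmp q r)
sameOrder-triple y w x p q r =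
  trans (cong₂ _∧_ (cong (yw ∧_) (∧-identityʳ yx)) (trans (∧-identityʳ (wx ∧ true)) (∧-identityʳ wx)))
        (∧-assoc yw yx wx)
  where
  yw yx wx : Bool
  yw = cmp y w ≡ᵇ cmp p q
  yx = cmp y x ≡ᵇ cmp p r
  wx = cmp w x ≡ᵇ cmp q r

-- The indices are exactly the comparisons isForbidden-triple has to evaluate.
data Comparison (x y : ℕ) : ℕ → Bool → Bool → Set where
  less    : x < y → Comparison x y 0 false false
  equal   : x ≡ y → Comparison x y 1 false true
  greater : y < x → Comparison x y 2 true false

compare : ∀ x y → Comparison x y (cmp x y) (y <ᵇ x) (x ≡ᵇ y)
compare x y with <-cmp x y
... | tri< x<y x≢y _ rewrite <ᵇ≡true x<y | <ᵇ≡false (<⇒≤ x<y) | ≡ᵇ≡false x≢y = less x<y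
... | tri≈ _ refl _ rewrite <ᵇ≡false (≤-refl {x}) | ≡ᵇ-refl x = equal refl
... | tri> _ x≢y y<x rewrite <ᵇ≡false (<⇒≤ y<x) | <ᵇ≡true y<x | ≡ᵇ≡false x≢y = greater y<x

isForbidden : Word → Bool
isForbidden w = sameOrder w (1 ∷ 2 ∷ 0 ∷ []) ∨ sameOrder w (2 ∷ 0 ∷ 1 ∷ []) ∨ sameOrder w (2 ∷ 1 ∷ 0 ∷ [])

isForbidden-cmp : ℕ → ℕ → ℕ → Bool
isForbidden-cmp c₁ c₂ c₃ = order 1 2 0 ∨ order 2 0 1 ∨ order 2 1 0
  where
  order : ℕ → ℕ → ℕ → Bool
  order p q r = (c₁ ≡ᵇ cmp p q) ∧ (c₂ ≡ᵇ cmp p r) ∧ (c₃ ≡ᵇ cmp q r)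

isForbidden-cmp-spec : ∀ {y w x c₁ c₂ c₃ g₁ g₂ g₃ e₁ e₂ e₃} →
  Comparison y w c₁ g₁ e₁ → Comparison y x c₂ g₂ e₂ → Comparison w x c₃ g₃ e₃ →
  isForbidden-cmp c₁ c₂ c₃ ≡ (g₂ ∧ not e₁) ∧ not e₃
isForbidden-cmp-spec (less _)    (less _)      _          = refl
isForbidden-cmp-spec (less _)    (equal _)     _          = refl
isForbidden-cmp-spec (equal _)   (less _)      _          = refl
isForbidden-cmp-spec (equal _)   (equal _)     _          = refl
isForbidden-cmp-spec (greater _) (less _)      _          = refl
isForbidden-cmp-spec (greater _) (equal _)     _          = refl
isForbidden-cmp-spec (equal _)   (greater _)   _          = refl
isForbidden-cmp-spec (less y<w)  (greater x<y) (less w<x) = ⊥-elim (<-asym x<y (<-trans y<w w<x))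
isForbidden-cmp-spec (less _)    (greater _)   (equal _)   = refl
isForbidden-cmp-spec (less _)    (greater _)   (greater _) = refl
isForbidden-cmp-spec (greater _) (greater _)   (less _)    = refl
isForbidden-cmp-spec (greater _) (greater _)   (equal _)   = refl
isForbidden-cmp-spec (greater _) (greater _)   (greater _) = refl

isForbidden-triple : ∀ y w x → isForbidden (y ∷ w ∷ x ∷ []) ≡ ((x <ᵇ y) ∧ not (y ≡ᵇ w)) ∧ not (w ≡ᵇ x)
isForbidden-triple y w x = begin
    isForbidden (y ∷ w ∷ x ∷ [])
  ≡⟨ cong₂ _∨_ (sameOrder-triple y w x 1 2 0)
               (cong₂ _∨_ (sameOrder-triple y w x 2 0 1) (sameOrder-triple y w x 2 1 0)) ⟩
    isForbidden-cmp (cmp y w) (cmp y x) (cmp w x)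
  ≡⟨ isForbidden-cmp-spec (compare y w) (compare y x) (compare w x) ⟩
    ((x <ᵇ y) ∧ not (y ≡ᵇ w)) ∧ not (w ≡ᵇ x)
  ∎
  where open ≡-Reasoning

isForbidden-length : ∀ w → length w ≢ 3 → isForbidden w ≡ false
isForbidden-length w ≢3
  rewrite sameOrder-length w (1 ∷ 2 ∷ 0 ∷ []) ≢3
        | sameOrder-length w (2 ∷ 0 ∷ 1 ∷ []) ≢3
        | sameOrder-length w (2 ∷ 1 ∷ 0 ∷ []) ≢3 = refl

avoids3-subseqs : ∀ w → avoids3 w ≡ not (any isForbidden (subseqs w))
avoids3-subseqs w = cong not (sym (trans (any-∨ (sameOrder-as (1 ∷ 2 ∷ 0 ∷ [])) _ (subseqs w))
  (cong (contains w (1 ∷ 2 ∷ 0 ∷ []) ∨_)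
        (any-∨ (sameOrder-as (2 ∷ 0 ∷ 1 ∷ [])) (sameOrder-as (2 ∷ 1 ∷ 0 ∷ [])) (subseqs w)))))
  where
  sameOrder-as : Word → Word → Bool
  sameOrder-as p s = sameOrder s p

completes : Word → ℕ → Bool
completes e x = any (λ s → isForbidden (s ++ [ x ])) (subseqs e)

aboveExcept : Word → ℕ → ℕ → Bool
aboveExcept e y i = any (λ z → (i <ᵇ z) ∧ not (z ≡ᵇ y)) e

avoids3-∷ʳ : ∀ e x → avoids3 e ≡ true → avoids3 (e ++ [ x ]) ≡ not (completes e x)
avoids3-∷ʳ e x avoids = begin
    avoids3 (e ++ [ x ])
  ≡⟨ avoids3-subseqs (e ++ [ x ]) ⟩
    not (any isForbidden (subseqs (e ++ [ x ])))
  ≡⟨ cong not (any-subseqs-∷ʳ isForbidden e x) ⟩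
    not (any isForbidden (subseqs e) ∨ completes e x)
  ≡⟨ deMorgan₂ (any isForbidden (subseqs e)) (completes e x) ⟩
    not (any isForbidden (subseqs e)) ∧ not (completes e x)
  ≡⟨ cong (_∧ not (completes e x)) (trans (sym (avoids3-subseqs e)) avoids) ⟩
    not (completes e x)
  ∎
  where open ≡-Reasoning

isForbidden-ending-in : ∀ e w x →
  any (λ s → isForbidden ((s ++ [ w ]) ++ [ x ])) (subseqs e) ≡ aboveExcept e w x ∧ not (w ≡ᵇ x)
isForbidden-ending-in e w x = begin
    any (λ s → isForbidden ((s ++ [ w ]) ++ [ x ])) (subseqs e)
  ≡⟨ any-subseqs-singletons _ e (isForbidden-length (w ∷ x ∷ []) λ ()) too-long ⟩
    any (λ y → isForbidden (y ∷ w ∷ x ∷ [])) e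
  ≡⟨ any-cong e (λ y → isForbidden-triple y w x) ⟩
    any (λ y → ((x <ᵇ y) ∧ not (y ≡ᵇ w)) ∧ not (w ≡ᵇ x)) e
  ≡⟨ any-∧ʳ _ (not (w ≡ᵇ x)) e ⟩
    aboveExcept e w x ∧ not (w ≡ᵇ x)
  ∎
  where
  open ≡-Reasoning
  ≢3 : ∀ {n} → suc (suc (suc (suc n))) ≢ 3
  ≢3 ()
  too-long : ∀ y z s → isForbidden (((y ∷ z ∷ s) ++ [ w ]) ++ [ x ]) ≡ false
  too-long y z s = isForbidden-length (((y ∷ z ∷ s) ++ [ w ]) ++ [ x ]) (≢3 ∘ trans (sym length≡))
    where
    length≡ : length (((y ∷ z ∷ s) ++ [ w ]) ++ [ x ]) ≡ suc (suc (suc (suc (length s))))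
    length≡ = cong (suc ∘ suc) (trans (length-∷ʳ (s ++ [ w ]) x) (cong suc (length-∷ʳ s w)))

completes-∷ʳ : ∀ e w x → completes (e ++ [ w ]) x ≡ completes e x ∨ (aboveExcept e w x ∧ not (w ≡ᵇ x))
completes-∷ʳ e w x =
  trans (any-subseqs-∷ʳ (λ s → isForbidden (s ++ [ x ])) e w)
        (cong (completes e x ∨_) (isForbidden-ending-in e w x))

aboveExcept-∷ʳ : ∀ e x y i → aboveExcept (e ++ [ x ]) y i ≡ aboveExcept e y i ∨ ((i <ᵇ x) ∧ not (x ≡ᵇ y))
aboveExcept-∷ʳ e x y i = any-∷ʳ (λ z → (i <ᵇ z) ∧ not (z ≡ᵇ y)) e x

completes-∷ʳ-old : ∀ e {i} x → completes e i ≡ true → completes (e ++ [ x ]) i ≡ true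
completes-∷ʳ-old e {i} x old rewrite completes-∷ʳ e x i | old = refl

completes-∷ʳ-new : ∀ e {i x} → aboveExcept e x i ≡ true → x ≢ i → completes (e ++ [ x ]) i ≡ true
completes-∷ʳ-new e {i} {x} above x≢i rewrite completes-∷ʳ e x i | above | ≡ᵇ≡false x≢i =
  ∨-zeroʳ (completes e i)

completes-∷ʳ-none : ∀ e {i x} → completes e i ≡ false → aboveExcept e x i ≡ false ⊎ x ≡ i →
  completes (e ++ [ x ]) i ≡ false
completes-∷ʳ-none e {i} {x} none (inj₁ not-above) rewrite completes-∷ʳ e x i | none | not-above = refl
completes-∷ʳ-none e {i} {x} none (inj₂ refl) rewrite completes-∷ʳ e x x | none | ≡ᵇ-refl x =
  ∧-zeroʳ (aboveExcept e x x)

aboveExcept-∷ʳ-old : ∀ e {y i} x → aboveExcept e y i ≡ true → aboveExcept (e ++ [ x ]) y i ≡ true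
aboveExcept-∷ʳ-old e {y} {i} x old rewrite aboveExcept-∷ʳ e x y i | old = refl

aboveExcept-∷ʳ-new : ∀ e {x y i} → i < x → x ≢ y → aboveExcept (e ++ [ x ]) y i ≡ true
aboveExcept-∷ʳ-new e {x} {y} {i} i<x x≢y rewrite aboveExcept-∷ʳ e x y i | <ᵇ≡true i<x | ≡ᵇ≡false x≢y =
  ∨-zeroʳ (aboveExcept e y i)

aboveExcept-∷ʳ-none : ∀ e {y i x} → aboveExcept e y i ≡ false → x ≤ i ⊎ x ≡ y →
  aboveExcept (e ++ [ x ]) y i ≡ false
aboveExcept-∷ʳ-none e {y} {i} {x} none (inj₁ x≤i)
  rewrite aboveExcept-∷ʳ e x y i | none | <ᵇ≡false x≤i = refl
aboveExcept-∷ʳ-none e {y} {i} {x} none (inj₂ refl) rewrite aboveExcept-∷ʳ e x x i | none | ≡ᵇ-refl x =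
  ∧-zeroʳ (i <ᵇ x)

-- Shapes and labels

-- above-<M and above-≥M say that M is the largest letter of e (if e ≠ []),
-- aboveM-≥a that every other letter is at most a.
record Shape (e : Word) (a s M c : ℕ) : Set where
  field
    avoids      : avoids3 e ≡ true
    length≡     : suc (length e) ≡ M + c
    a+s≤M       : a + s ≤ M
    blocked-low : ∀ {i} → i < a → completes e i ≡ true
    free-low    : ∀ {i} → a ≤ i → i < a + s → completes e i ≡ false
    blocked-mid : ∀ {i} → a + s ≤ i → i < M → completes e i ≡ true
    free-high   : ∀ {i} → M ≤ i → completes e i ≡ false
    above-<M    : ∀ {y i} → y ≢ M → i < M → aboveExcept e y i ≡ true
    above-≥M    : ∀ {y i} → M ≤ i → aboveExcept e y i ≡ false
    aboveM-≥a   : ∀ {i} → a ≤ i → aboveExcept e M i ≡ false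

shape-[] : Shape [] 0 0 0 1
shape-[] = record
  { avoids = refl ; length≡ = refl ; a+s≤M = z≤n
  ; blocked-low = λ () ; free-low = λ _ () ; blocked-mid = λ _ () ; free-high = λ _ → refl
  ; above-<M = λ _ () ; above-≥M = λ _ → refl ; aboveM-≥a = λ _ → refl
  }

length≡-∷ʳ : ∀ (e : Word) M c x → suc (length e) ≡ M + c → suc (length (e ++ [ x ])) ≡ M + suc c
length≡-∷ʳ e M c x length≡ = trans (cong suc (trans (length-∷ʳ e x) length≡)) (sym (+-suc M c))

shape-∷ʳ-max : ∀ {e a s M c} → Shape e a s M c → Shape (e ++ [ M ]) a s M (suc c)
shape-∷ʳ-max {e} {a} {s} {M} {c} S = record
  { avoids      = trans (avoids3-∷ʳ e M avoids) (cong not (free-high ≤-refl))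
  ; length≡     = length≡-∷ʳ e M c M length≡
  ; a+s≤M       = a+s≤M
  ; blocked-low = λ i<a → completes-∷ʳ-old e M (blocked-low i<a)
  ; free-low    = λ a≤i i<a+s → completes-∷ʳ-none e (free-low a≤i i<a+s) (inj₁ (aboveM-≥a a≤i))
  ; blocked-mid = λ a+s≤i i<M → completes-∷ʳ-old e M (blocked-mid a+s≤i i<M)
  ; free-high   = λ M≤i → completes-∷ʳ-none e (free-high M≤i) (inj₁ (above-≥M M≤i))
  ; above-<M    = λ y≢M i<M → aboveExcept-∷ʳ-old e M (above-<M y≢M i<M)
  ; above-≥M    = λ M≤i → aboveExcept-∷ʳ-none e (above-≥M M≤i) (inj₁ M≤i)
  ; aboveM-≥a   = λ a≤i → aboveExcept-∷ʳ-none e (aboveM-≥a a≤i) (inj₂ refl)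
  }
  where open Shape S

shape-∷ʳ-low : ∀ {e a s M c t} → Shape e a s M c → t < s → Shape (e ++ [ a + t ]) (a + t) 1 M (suc c)
shape-∷ʳ-low {e} {a} {s} {M} {c} {t} S t<s = record
  { avoids      = trans (avoids3-∷ʳ e x avoids) (cong not (free-low a≤x x<a+s))
  ; length≡     = length≡-∷ʳ e M c x length≡
  ; a+s≤M       = subst (_≤ M) (+-comm 1 x) x<M
  ; blocked-low = λ i<x → completes-∷ʳ-new e (above-<M x≢M (<-trans i<x x<M)) (>⇒≢ i<x)
  ; free-low    = free-at-x
  ; blocked-mid = λ {i} x+1≤i i<M →
      completes-∷ʳ-new e (above-<M x≢M i<M) (<⇒≢ {x} (subst (_≤ i) (+-comm x 1) x+1≤i))
  ; free-high   = λ M≤i → completes-∷ʳ-none e (free-high M≤i) (inj₁ (above-≥M M≤i))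
  ; above-<M    = λ y≢M i<M → aboveExcept-∷ʳ-old e x (above-<M y≢M i<M)
  ; above-≥M    = λ M≤i → aboveExcept-∷ʳ-none e (above-≥M M≤i) (inj₁ (≤-trans (<⇒≤ x<M) M≤i))
  ; aboveM-≥a   = λ x≤i → aboveExcept-∷ʳ-none e (aboveM-≥a (≤-trans a≤x x≤i)) (inj₁ x≤i)
  }
  where
  open Shape S
  x : ℕ
  x = a + t
  a≤x : a ≤ x
  a≤x = m≤m+n a t
  x<a+s : x < a + s
  x<a+s = +-monoʳ-< a t<s
  x<M : x < M
  x<M = <-≤-trans x<a+s a+s≤M
  x≢M : x ≢ M
  x≢M = <⇒≢ x<M
  free-at-x : ∀ {i} → x ≤ i → i < x + 1 → completes (e ++ [ x ]) i ≡ false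
  free-at-x {i} x≤i i<x+1 with ≤-antisym x≤i (≤-pred (subst (i <_) (+-comm x 1) i<x+1))
  ... | refl = completes-∷ʳ-none e (free-low a≤x x<a+s) (inj₂ refl)

shape-∷ʳ-high : ∀ {e a s M c t} → Shape e a s M (suc (suc (t + c))) →
  Shape (e ++ [ M + suc t ]) M (suc t) (M + suc t) (suc (suc c))
shape-∷ʳ-high {e} {a} {s} {M} {c} {t} S = record
  { avoids      = trans (avoids3-∷ʳ e x avoids) (cong not (free-high M≤x))
  ; length≡     = trans (length≡-∷ʳ e M _ x length≡) (sym M+[1+t]+[2+c])
  ; a+s≤M       = ≤-refl
  ; blocked-low = λ i<M → completes-∷ʳ-new e (above-<M x≢M i<M) (>⇒≢ (<-trans i<M M<x))
  ; free-low    = λ M≤i _ → completes-∷ʳ-none e (free-high M≤i) (inj₁ (above-≥M M≤i))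
  ; blocked-mid = λ x≤i i<x → ⊥-elim (≤⇒≯ x≤i i<x)
  ; free-high   = λ x≤i → let M≤i = ≤-trans M≤x x≤i in completes-∷ʳ-none e (free-high M≤i) (inj₁ (above-≥M M≤i))
  ; above-<M    = λ y≢x i<x → aboveExcept-∷ʳ-new e i<x (≢-sym y≢x)
  ; above-≥M    = λ x≤i → aboveExcept-∷ʳ-none e (above-≥M (≤-trans M≤x x≤i)) (inj₁ x≤i)
  ; aboveM-≥a   = λ M≤i → aboveExcept-∷ʳ-none e (above-≥M M≤i) (inj₂ refl)
  }
  where
  open Shape S
  x : ℕ
  x = M + suc t
  M≤x : M ≤ x
  M≤x = m≤m+n M (suc t)
  M<x : M < x
  M<x = m<m+n M z<s
  x≢M : x ≢ M
  x≢M = >⇒≢ M<x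
  M+[1+t]+[2+c] : M + suc t + suc (suc c) ≡ M + suc (suc (suc (t + c)))
  M+[1+t]+[2+c] =
    trans (+-assoc M (suc t) _) (cong (λ n → M + suc n) (trans (+-suc t (suc c)) (cong suc (+-suc t c))))

children-shape : ∀ {e a s M c} → Shape e a s M c →
  children e ≡ applyUpTo (λ t → e ++ [ a + t ]) s ++ applyUpTo (λ t → e ++ [ M + t ]) c
children-shape {e} {a} {s} {M} {c} S = begin
    children e
  ≡⟨ cong (filter avoids?) (trans (map-upTo append (suc (length e))) (cong (applyUpTo append) length≡)) ⟩
    filter avoids? (applyUpTo append (M + c))
  ≡⟨ cong (filter avoids?) (applyUpTo-+ append M c) ⟩
    filter avoids? (applyUpTo append M ++ applyUpTo (append ∘ (M +_)) c)
  ≡⟨ filter-++ avoids? (applyUpTo append M) _ ⟩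
    filter avoids? (applyUpTo append M) ++ filter avoids? (applyUpTo (append ∘ (M +_)) c)
  ≡⟨ cong₂ _++_
       (filter-applyUpTo-interval avoids? append a+s≤M
          (blocked ∘ blocked-low) (λ h₁ h₂ → free (free-low h₁ h₂)) (λ h₁ h₂ → blocked (blocked-mid h₁ h₂)))
       (filter-all avoids? (applyUpTo⁺₁ (append ∘ (M +_)) c (λ _ → free (free-high (m≤m+n M _))))) ⟩
    applyUpTo (λ t → e ++ [ a + t ]) s ++ applyUpTo (λ t → e ++ [ M + t ]) c
  ∎
  where
  open ≡-Reasoning
  open Shape S
  append : ℕ → Word
  append i = e ++ [ i ]
  avoids? : Decidable (λ w → avoids3 w ≡ true)
  avoids? w = avoids3 w ≟ true
  free : ∀ {i} → completes e i ≡ false → avoids3 (append i) ≡ true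
  free none = trans (avoids3-∷ʳ e _ avoids) (cong not none)
  blocked : ∀ {i} → completes e i ≡ true → avoids3 (append i) ≢ true
  blocked {i} some avoids-i with () ← trans (sym (trans (avoids3-∷ʳ e i avoids) (cong not some))) avoids-i

HasLabel : Word → ℕ → ℕ → Set
HasLabel e s c = Σ ℕ λ a → Σ ℕ λ M → Shape e a s M c

SameLabel : Word → Word → Set
SameLabel x y = Σ ℕ λ s → Σ ℕ λ c → HasLabel x s c × HasLabel y s c

children-sameLabel : ∀ x y → SameLabel x y → Pointwise SameLabel (children x) (children y)
children-sameLabel x y (s , c , (a , M , X) , (a′ , M′ , Y))
  rewrite children-shape X | children-shape Y = ++⁺ (applyUpTo⁺ _ _ s low) (applyUpTo⁺ _ _ c high)
  where
  low : ∀ {t} → t < s → SameLabel (x ++ [ a + t ]) (y ++ [ a′ + t ])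
  low t<s = 1 , suc c , (_ , M , shape-∷ʳ-low X t<s) , (_ , M′ , shape-∷ʳ-low Y t<s)
  high : ∀ {t} → t < c → SameLabel (x ++ [ M + t ]) (y ++ [ M′ + t ])
  high {zero} _ rewrite +-identityʳ M | +-identityʳ M′ =
    s , suc c , (a , M , shape-∷ʳ-max X) , (a′ , M′ , shape-∷ʳ-max Y)
  high {suc t} t<c with m≤n⇒∃[o]m+o≡n t<c
  ... | c′ , refl = suc t , suc (suc c′) , (M , _ , shape-∷ʳ-high X) , (M′ , _ , shape-∷ʳ-high Y)

sameLabel⇒≅ : ∀ {x y s c} → HasLabel x s c → HasLabel y s c → x ≅ y
sameLabel⇒≅ X Y = SameLabel , (_ , _ , X , Y) , children-sameLabel

-- The words a_m and b_{m,j}, written with j = suc t and m = j + r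

shape-aw : ∀ m → Shape (aw m) 0 0 0 (suc m)
shape-aw zero = shape-[]
shape-aw (suc m) = subst (λ w → Shape w 0 0 0 (suc (suc m))) (replicate-∷ʳ m 0) (shape-∷ʳ-max (shape-aw m))

shape-bw : ∀ t r → Shape (bw (suc t + r) (suc t)) 0 (suc t) (suc t) (suc (suc r))
shape-bw t r = shape-∷ʳ-high (shape-aw (suc t + r))

children-aw : ∀ m → children (aw m) ≡ aw (suc m) ∷ map (λ j → bw m j) (map suc (upTo m))
children-aw m = begin
    children (aw m)
  ≡⟨ children-shape (shape-aw m) ⟩
    (aw m ++ [ 0 ]) ∷ applyUpTo (bw m ∘ suc) m
  ≡⟨ cong₂ _∷_ (replicate-∷ʳ m 0)
              (sym (trans (cong (map (bw m)) (map-upTo suc m)) (map-applyUpTo suc (bw m) m))) ⟩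
    aw (suc m) ∷ map (λ j → bw m j) (map suc (upTo m))
  ∎
  where open ≡-Reasoning

children-bw : ∀ t r → let m = suc t + r in
  children (bw m (suc t)) ≡ map (λ k → bw m (suc t) ++ [ k ]) (upTo (m + 2))
children-bw t r = begin
    children (bw m (suc t))
  ≡⟨ children-shape (shape-bw t r) ⟩
    applyUpTo append (suc t) ++ applyUpTo (append ∘ (suc t +_)) (suc (suc r))
  ≡⟨ sym (applyUpTo-+ append (suc t) (suc (suc r))) ⟩
    applyUpTo append (suc t + suc (suc r))
  ≡⟨ cong (applyUpTo append) (trans (cong (suc t +_) (+-comm 2 r)) (sym (+-assoc (suc t) r 2))) ⟩
    applyUpTo append (m + 2)
  ≡⟨ sym (map-upTo append (m + 2)) ⟩
    map append (upTo (m + 2))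
  ∎
  where
  open ≡-Reasoning
  m : ℕ
  m = suc t + r
  append : ℕ → Word
  append k = bw m (suc t) ++ [ k ]

bw-∷ʳ-low-≅ : ∀ t r k → k < suc t → (bw (suc t + r) (suc t) ++ [ k ]) ≅ bw (suc (suc r)) 1
bw-∷ʳ-low-≅ t r k k<j = sameLabel⇒≅ (k , suc t , shape-∷ʳ-low (shape-bw t r) k<j) (0 , 1 , shape-bw 0 (suc r))

bw-∷ʳ-max-≅ : ∀ t r → (bw (suc t + r) (suc t) ++ [ suc t ]) ≅ bw (suc t + suc r) (suc t)
bw-∷ʳ-max-≅ t r = sameLabel⇒≅ (0 , suc t , shape-∷ʳ-max (shape-bw t r)) (0 , suc t , shape-bw t (suc r))

bw-∷ʳ-high-≅ : ∀ t d r → (bw (suc t + (d + r)) (suc t) ++ [ suc t + suc d ]) ≅ bw (suc d + r) (suc d)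
bw-∷ʳ-high-≅ t d r = sameLabel⇒≅ (suc t , _ , shape-∷ʳ-high (shape-bw t (d + r))) (0 , suc d , shape-bw d r)

successors-bw : ∀ (m j : ℕ) → 1 ≤ j → j ≤ m →
    (children (bw m j) ≡ map (λ k → bw m j ++ [ k ]) (upTo (m + 2)))
    × (∀ (k : ℕ) → k < j → (bw m j ++ [ k ]) ≅ bw (m + 2 ∸ j) 1)
    × ((bw m j ++ [ j ]) ≅ bw (m + 1) j)
    × (∀ (k : ℕ) → j + 1 ≤ k → k ≤ m + 1 → (bw m j ++ [ k ]) ≅ bw (m + 1 ∸ j) (k ∸ j))
successors-bw m (suc t) _ j≤m with m≤n⇒∃[o]m+o≡n j≤m
... | r , refl = children-bw t r , low , max , high
  where
  b : Word
  b = bw (suc t + r) (suc t)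
  m+1≡j+[1+r] : suc t + r + 1 ≡ suc t + suc r
  m+1≡j+[1+r] = trans (+-assoc (suc t) r 1) (cong (suc t +_) (+-comm r 1))
  m+2∸j≡2+r : suc t + r + 2 ∸ suc t ≡ suc (suc r)
  m+2∸j≡2+r = trans (cong (_∸ suc t) (+-assoc (suc t) r 2)) (trans (m+n∸m≡n (suc t) (r + 2)) (+-comm r 2))
  d≤r : ∀ {d} → suc t + 1 + d ≤ suc t + r + 1 → d ≤ r
  d≤r {d} k≤m+1 =
    ≤-pred (+-cancelˡ-≤ (suc t) (suc d) (suc r) (subst₂ _≤_ (+-assoc (suc t) 1 d) m+1≡j+[1+r] k≤m+1))

  low : ∀ k → k < suc t → (b ++ [ k ]) ≅ bw (suc t + r + 2 ∸ suc t) 1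
  low k k<j = subst (λ n → (b ++ [ k ]) ≅ bw n 1) (sym m+2∸j≡2+r) (bw-∷ʳ-low-≅ t r k k<j)

  max : (b ++ [ suc t ]) ≅ bw (suc t + r + 1) (suc t)
  max = subst (λ n → (b ++ [ suc t ]) ≅ bw n (suc t)) (sym m+1≡j+[1+r]) (bw-∷ʳ-max-≅ t r)

  high : ∀ k → suc t + 1 ≤ k → k ≤ suc t + r + 1 → (b ++ [ k ]) ≅ bw (suc t + r + 1 ∸ suc t) (k ∸ suc t)
  high k j+1≤k k≤m+1 with m≤n⇒∃[o]m+o≡n j+1≤k
  ... | d , refl with m≤n⇒∃[o]m+o≡n (d≤r k≤m+1)
  ... | r′ , refl =
    subst₂ (λ k n → (b ++ [ k ]) ≅ bw n (k ∸ suc t)) (sym (+-assoc (suc t) 1 d)) (sym m+1∸j≡1+d+r′)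
      (subst (λ u → (b ++ [ suc t + suc d ]) ≅ bw (suc d + r′) u) (sym (m+n∸m≡n (suc t) (suc d)))
        (bw-∷ʳ-high-≅ t d r′))
    where
    m+1∸j≡1+d+r′ : suc t + (d + r′) + 1 ∸ suc t ≡ suc d + r′
    m+1∸j≡1+d+r′ = trans (cong (_∸ suc t) m+1≡j+[1+r]) (m+n∸m≡n (suc t) (suc (d + r′)))

lemma1 : (∀ (m : ℕ) → 1 ≤ m →
              children (aw m) ≡ aw (suc m) ∷ map (λ j → bw m j) (map suc (upTo m)))
           × (∀ (m j : ℕ) → 1 ≤ j → j ≤ m →
              (children (bw m j) ≡ map (λ k → bw m j ++ [ k ]) (upTo (m + 2)))
              × (∀ (k : ℕ) → k < j → (bw m j ++ [ k ]) ≅ bw (m + 2 ∸ j) 1)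
              × ((bw m j ++ [ j ]) ≅ bw (m + 1) j)
              × (∀ (k : ℕ) → j + 1 ≤ k → k ≤ m + 1 → (bw m j ++ [ k ]) ≅ bw (m + 1 ∸ j) (k ∸ j)))
lemma1 = (λ m _ → children-aw m) , successors-bw
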